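{- For all $n\in\mathbb{N}$, we have $\mathrm{ex}(n,K_{5}^{(3)- })\geq\mathrm{ex}(n,K_{4}^{(3)})+\left\lfloor\frac{n}{5}\right\rfloor$.
   Context: A $3$-graph $H=(V,E)$ has $E\subseteq\binom{V}{3}$. $H$ is $F$-free if it contains no copy of $F$. $\mathrm{ex}(n,F)$ is the maximum number of edges of an $F$-free $3$-graph on $n$ vertices. $K_4^{(3)}$ is the complete $3$-graph on $4$ vertices and $K_5^{(3)- }$ is the complete $3$-graph on $5$ vertices with one edge removed. -}

module Defs where

open import Data.Nat using (ℕ; _<_)
open import Data.Fin using (Fin; toℕ)
open import Data.Bool using (Bool; true; false; _∧_; not)
open import Data.List using (List; length; filterᵇ; allFin; concatMap; map)
open import Data.Product using (Σ; _×_; _,_; ∃)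
open import Relation.Binary.PropositionalEquality using (_≡_; _≢_; refl; sym; trans; cong; cong₂)
open import Data.Empty using (⊥-elim)
open import Function.Definitions using (Injective)
open import Relation.Nullary using (¬_; yes; no)
open import Relation.Nullary.Decidable using (⌊_⌋)
import Data.Nat as ℕ
open import Data.Bool.Properties using (∧-assoc; ∧-comm)

-- A 3-graph on the vertex set Fin n: an indicator H on ordered triples that
-- is symmetric under all permutations and false on non-distinct triples,
-- so that it encodes a set of 3-element subsets of Fin n.
record ThreeGraph (n : ℕ) : Set where
  field
    edge    : Fin n → Fin n → Fin n → Bool
    sym₁₂   : ∀ a b c → edge a b c ≡ edge b a c
    sym₂₃   : ∀ a b c → edge a b c ≡ edge a c b
    distinct : ∀ a b c → edge a b c ≡ true → (a ≢ b) × (b ≢ c) × (a ≢ c)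
open ThreeGraph public

triples : (n : ℕ) → List (Fin n × Fin n × Fin n)
triples n = concatMap (λ i → concatMap (λ j → map (λ k → (i , j , k)) (allFin n)) (allFin n)) (allFin n)

isIncreasingEdge : ∀ {n} → ThreeGraph n → Fin n × Fin n × Fin n → Bool
isIncreasingEdge H (i , j , k) =
  ⌊ toℕ i ℕ.<? toℕ j ⌋ ∧ ⌊ toℕ j ℕ.<? toℕ k ⌋ ∧ edge H i j k

numEdges : ∀ {n} → ThreeGraph n → ℕ
numEdges {n} H = length (filterᵇ (isIncreasingEdge H) (triples n))

ContainsCopy : ∀ {n k} → ThreeGraph n → ThreeGraph k → Set
ContainsCopy {n} {k} H F =
  Σ (Fin k → Fin n) λ φ → Injective _≡_ _≡_ φ ×
    (∀ a b c → edge F a b c ≡ true → edge H (φ a) (φ b) (φ c) ≡ true)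

Free : ∀ {n k} → ThreeGraph k → ThreeGraph n → Set
Free F H = ¬ ContainsCopy H F

IsEx : ∀ {k} → (n : ℕ) → ThreeGraph k → ℕ → Set
IsEx n F m =
  (Σ (ThreeGraph n) λ H → Free F H × numEdges H ≡ m) ×
  (∀ (H : ThreeGraph n) → Free F H → numEdges H ℕ.≤ m)

neq : ∀ {n} → Fin n → Fin n → Bool
neq a b = not ⌊ a Data.Fin.≟ b ⌋

neq-sym : ∀ {n} (a b : Fin n) → neq a b ≡ neq b a
neq-sym a b with a Data.Fin.≟ b | b Data.Fin.≟ a
... | yes _ | yes _ = refl
... | no _ | no _ = refl
... | yes p | no q = ⊥-elim (q (sym p))
... | no p | yes q = ⊥-elim (p (sym q))

neq-true : ∀ {n} (a b : Fin n) → neq a b ≡ true → a ≢ b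
neq-true a b e with a Data.Fin.≟ b
neq-true a b () | yes _
... | no p = p

distinct3 : ∀ {n} → Fin n → Fin n → Fin n → Bool
distinct3 a b c = neq a b ∧ neq b c ∧ neq a c

d-sym₁₂ : ∀ {n} (a b c : Fin n) → distinct3 a b c ≡ distinct3 b a c
d-sym₁₂ a b c rewrite neq-sym a b with neq b a | neq b c | neq a c
... | false | _ | _ = refl
... | true | x | y rewrite ∧-comm x y = refl

d-sym₂₃ : ∀ {n} (a b c : Fin n) → distinct3 a b c ≡ distinct3 a c b
d-sym₂₃ a b c rewrite neq-sym b c with neq a b | neq c b | neq a c
... | true | true | true = refl
... | true | true | false = refl
... | true | false | true = refl
... | true | false | false = refl
... | false | true | true = refl
... | false | true | false = refl
... | false | false | true = refl
... | false | false | false = refl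

d-true : ∀ {n} (a b c : Fin n) → distinct3 a b c ≡ true → (a ≢ b) × (b ≢ c) × (a ≢ c)
d-true a b c e with neq a b in e1 | neq b c in e2 | neq a c in e3
... | true | true | true = neq-true a b e1 , neq-true b c e2 , neq-true a c e3
d-true a b c () | false | _ | _
d-true a b c () | true | false | _
d-true a b c () | true | true | false

K4 : ThreeGraph 4
K4 = record { edge = distinct3 ; sym₁₂ = d-sym₁₂ ; sym₂₃ = d-sym₂₃ ; distinct = d-true }

-- K_5^(3)-: the complete 3-graph on Fin 5 minus the single edge {2,3,4}
-- (all 3-subsets except those contained in {2,3,4})
big : Fin 5 → Bool
big a = ⌊ 2 ℕ.≤? toℕ a ⌋

missing : Fin 5 → Fin 5 → Fin 5 → Bool
missing a b c = big a ∧ big b ∧ big c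

K5⁻edge : Fin 5 → Fin 5 → Fin 5 → Bool
K5⁻edge a b c = distinct3 a b c ∧ not (missing a b c)

K5⁻ : ThreeGraph 5
K5⁻ = record
  { edge = K5⁻edge
  ; sym₁₂ = λ a b c → cong₂ _∧_ (d-sym₁₂ a b c) (cong not (m₁₂ a b c))
  ; sym₂₃ = λ a b c → cong₂ _∧_ (d-sym₂₃ a b c) (cong not (m₂₃ a b c))
  ; distinct = λ a b c e → d-true a b c (∧-true₁ (distinct3 a b c) _ e)
  }
  where
  m₁₂ : ∀ a b c → missing a b c ≡ missing b a c
  m₁₂ a b c = trans (sym (∧-assoc (big a) (big b) (big c)))
              (trans (cong (_∧ big c) (∧-comm (big a) (big b))) (∧-assoc (big b) (big a) (big c)))
  m₂₃ : ∀ a b c → missing a b c ≡ missing a c b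
  m₂₃ a b c = cong (big a ∧_) (∧-comm (big b) (big c))
  ∧-true₁ : ∀ x y → x ∧ y ≡ true → x ≡ true
  ∧-true₁ true y _ = refl
  ∧-true₁ false y ()

{-# OPTIONS --safe #-}
-- Let H be a K₄-free 3-graph with ex(n, K₄) edges. Cut 4⌊n/5⌋ ≤ n vertices into ⌊n/5⌋
-- blocks of four. Being K₄-free, H misses some triple inside each block; adding these
-- pairwise disjoint triples gives ⌊n/5⌋ new edges. The result is K₅⁻-free: deleting a
-- vertex of the missing edge of a K₅⁻ leaves three K₄s, each of which must contain an
-- added triple. Two triples inside five vertices meet, so all three K₄s contain the same
-- triple, which is impossible since they only share two vertices.
module Submission where

open import Defs
open import Data.Nat using (ℕ; _+_; _≤_; _/_)
open import Data.Nat using (zero; suc; _*_; z≤n; s≤s)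

open import Algebra.Bundles using (CommutativeMonoid)
open import Data.Bool using (Bool; true; false; _∧_; _∨_; not; T)
open import Data.Bool.Properties using (∧-commutativeMonoid; ∧-zeroʳ; ∨-zeroʳ; ¬-not)
  renaming (_≟_ to _≟ᵇ_)
open import Data.Empty using (⊥; ⊥-elim)
open import Data.Fin using (Fin; zero; suc; toℕ; punchIn; combine; inject≤; _≟_)
  renaming (_<_ to _<ᶠ_; _<?_ to _<?ᶠ_)
open import Data.Fin.Patterns using (0F; 1F; 2F; 3F)
open import Data.Fin.Properties
  using (<-cmp; <⇒≢; ≤∧≢⇒<; punchIn-mono-≤; punchIn-injective; combine-injective;
         inject≤-injective; toℕ-inject≤; toℕ-combine; injective⇒≤; all?; any?; ¬∀⟶∃¬)
open import Data.List using (List; []; _∷_; length; filterᵇ; lookup)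
open import Data.List.Membership.Propositional using (_∈_; lose)
open import Data.List.Membership.Propositional.Properties
  using (∈-map⁺; ∈-concatMap⁺; ∈-allFin; ∈-filter⁺)
open import Data.List.Relation.Unary.Any using (index)
open import Data.List.Relation.Unary.Any.Properties using (lookup-index)
open import Data.Nat.DivMod using (m/n*n≤m)
import Data.Nat.Properties as ℕ
open import Data.Product using (∃; _×_; _,_; proj₁; proj₂; uncurry)
open import Data.Sum using (_⊎_; inj₁; inj₂; [_,_]′)
open import Data.Unit using (tt)
open import Function using (_∘_; id)
open import Function.Definitions using (Injective)
open import Relation.Binary.Definitions using (tri<; tri≈; tri>)
open import Relation.Binary.PropositionalEquality
  using (_≡_; _≢_; refl; sym; trans; cong; cong₂; subst)
open import Relation.Nullary using (Dec; does; yes; no)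
open import Relation.Nullary.Decidable
  using (⌊_⌋; from-yes; ¬?; _→-dec_; _⊎-dec_; _×-dec_; dec-true; T?)
open import Relation.Unary using (Pred; Decidable)

open import Algebra.Properties.CommutativeSemigroup
  (CommutativeMonoid.commutativeSemigroup ∧-commutativeMonoid) using (x∙yz≈y∙xz; x∙yz≈x∙zy)

private
  variable
    n m : ℕ

∨-true⁻ : ∀ {x y} → x ∨ y ≡ true → x ≡ true ⊎ y ≡ true
∨-true⁻ {true}  _ = inj₁ refl
∨-true⁻ {false} e = inj₂ e

∧-true⁻ : ∀ {x y} → x ∧ y ≡ true → x ≡ true × y ≡ true
∧-true⁻ {true} e = refl , e

∧∧-monoʳ : ∀ a b {c d} → (c ≡ true → d ≡ true) →
           a ∧ b ∧ c ≡ true → a ∧ b ∧ d ≡ true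
∧∧-monoʳ true true c⇒d = c⇒d

does-true⁻ : ∀ {p} {P : Set p} (P? : Dec P) → does P? ≡ true → P
does-true⁻ (yes p) _ = p

⌊⌋-true : ∀ {p} {P : Set p} (P? : Dec P) → P → ⌊ P? ⌋ ≡ true
⌊⌋-true (yes _) _ = refl
⌊⌋-true (no ¬p) p = ⊥-elim (¬p p)

neq-intro : {x y : Fin n} → x ≢ y → neq x y ≡ true
neq-intro {x = x} {y} x≢y with x ≟ y
... | yes x≡y = ⊥-elim (x≢y x≡y)
... | no _    = refl

Fin3-exhausted : ∀ (i j k l : Fin 3) → i ≢ j → j ≢ k → i ≢ k →
                 l ≡ i ⊎ l ≡ j ⊎ l ≡ k
Fin3-exhausted = from-yes
  (all? {n = 3} λ i → all? {n = 3} λ j → all? {n = 3} λ k → all? {n = 3} λ l →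
     ¬? (i ≟ j) →-dec ¬? (j ≟ k) →-dec ¬? (i ≟ k) →-dec (l ≟ i ⊎-dec l ≟ j ⊎-dec l ≟ k))

increasing-is-face : ∀ {a b c : Fin 4} → a <ᶠ b → b <ᶠ c →
                     ∃ λ k → punchIn k 0F ≡ a × punchIn k 1F ≡ b × punchIn k 2F ≡ c
increasing-is-face {a} {b} {c} = from-yes
  (all? {n = 4} λ a → all? {n = 4} λ b → all? {n = 4} λ c → a <?ᶠ b →-dec b <?ᶠ c →-dec
     any? λ k → punchIn k 0F ≟ a ×-dec punchIn k 1F ≟ b ×-dec punchIn k 2F ≟ c)
  a b c

punchIn-mono-< : ∀ (k : Fin (suc n)) {i j} → i <ᶠ j → punchIn k i <ᶠ punchIn k j
punchIn-mono-< k {i} {j} i<j =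
  ≤∧≢⇒< (punchIn-mono-≤ k i j (ℕ.<⇒≤ i<j)) (<⇒≢ i<j ∘ punchIn-injective k i j)

edgeOn : ThreeGraph n → (Fin 3 → Fin n) → Bool
edgeOn G τ = edge G (τ 0F) (τ 1F) (τ 2F)

_⊆_ : ThreeGraph n → ThreeGraph n → Set
G ⊆ G′ = ∀ {x y z} → edge G x y z ≡ true → edge G′ x y z ≡ true

_∪_ : ThreeGraph n → ThreeGraph n → ThreeGraph n
G ∪ G′ = record
  { edge     = λ x y z → edge G x y z ∨ edge G′ x y z
  ; sym₁₂    = λ x y z → cong₂ _∨_ (sym₁₂ G x y z) (sym₁₂ G′ x y z)
  ; sym₂₃    = λ x y z → cong₂ _∨_ (sym₂₃ G x y z) (sym₂₃ G′ x y z)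
  ; distinct = λ x y z → [ distinct G x y z , distinct G′ x y z ]′ ∘ ∨-true⁻
  }

G⊆G∪G′ : ∀ (G G′ : ThreeGraph n) → G ⊆ (G ∪ G′)
G⊆G∪G′ G G′ {x} {y} {z} = cong (_∨ edge G′ x y z)

G′⊆G∪G′ : ∀ (G G′ : ThreeGraph n) → G′ ⊆ (G ∪ G′)
G′⊆G∪G′ G G′ {x} {y} {z} e = trans (cong (edge G x y z ∨_) e) (∨-zeroʳ _)

∅ : ThreeGraph n
∅ = record
  { edge     = λ _ _ _ → false
  ; sym₁₂    = λ _ _ _ → refl
  ; sym₂₃    = λ _ _ _ → refl
  ; distinct = λ _ _ _ ()
  }

⋃ : (Fin m → ThreeGraph n) → ThreeGraph n
⋃ {zero}  G = ∅
⋃ {suc m} G = G zero ∪ ⋃ (G ∘ suc)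

Gb⊆⋃G : ∀ (G : Fin m → ThreeGraph n) b → G b ⊆ ⋃ G
Gb⊆⋃G G zero    = G⊆G∪G′ (G zero) (⋃ (G ∘ suc))
Gb⊆⋃G G (suc b) = G′⊆G∪G′ (G zero) (⋃ (G ∘ suc)) ∘ Gb⊆⋃G (G ∘ suc) b

⋃-edge⁻ : ∀ (G : Fin m → ThreeGraph n) {x y z} →
          edge (⋃ G) x y z ≡ true → ∃ λ b → edge (G b) x y z ≡ true
⋃-edge⁻ {suc m} G {x} {y} {z} e with ∨-true⁻ {edge (G zero) x y z} e
... | inj₁ e₀ = zero , e₀
... | inj₂ e₊ with b , eᵦ ← ⋃-edge⁻ (G ∘ suc) e₊ = suc b , eᵦ

clique : ∀ {p} {P : Pred (Fin n) p} → Decidable P → ThreeGraph n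
clique P? = record
  { edge     = λ x y z → distinct3 x y z ∧ (does (P? x) ∧ (does (P? y) ∧ does (P? z)))
  ; sym₁₂    = λ x y z → cong₂ _∧_ (d-sym₁₂ x y z)
                                     (x∙yz≈y∙xz (does (P? x)) (does (P? y)) (does (P? z)))
  ; sym₂₃    = λ x y z → cong₂ _∧_ (d-sym₂₃ x y z)
                                     (x∙yz≈x∙zy (does (P? x)) (does (P? y)) (does (P? z)))
  ; distinct = λ x y z → d-true x y z ∘ proj₁ ∘ ∧-true⁻
  }

module _ {p} {P : Pred (Fin n) p} (P? : Decidable P) where

  clique-edge⁺ : ∀ {x y z} → x ≢ y → y ≢ z → x ≢ z → P x → P y → P z →
                 edge (clique P?) x y z ≡ true
  clique-edge⁺ {x} {y} {z} x≢y y≢z x≢z px py pz =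
    cong₂ _∧_ (cong₂ _∧_ (neq-intro x≢y) (cong₂ _∧_ (neq-intro y≢z) (neq-intro x≢z)))
              (cong₂ _∧_ (dec-true (P? x) px) (cong₂ _∧_ (dec-true (P? y) py) (dec-true (P? z) pz)))

  clique-edge⁻ : ∀ {x y z} → edge (clique P?) x y z ≡ true →
                 ((x ≢ y) × (y ≢ z) × (x ≢ z)) × P x × P y × P z
  clique-edge⁻ {x} {y} {z} e
    with d  , e′ ← ∧-true⁻ {distinct3 x y z} e
    with px , e″ ← ∧-true⁻ {does (P? x)} e′
    with py , pz ← ∧-true⁻ {does (P? y)} e″
    = d-true x y z d , does-true⁻ (P? x) px , does-true⁻ (P? y) py , does-true⁻ (P? z) pz

module _ (G : ThreeGraph n) {k} (ψ : Fin k → Fin n) where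

  private
    R : Fin k → Fin k → Fin k → Set
    R a b c = edge G (ψ a) (ψ b) (ψ c) ≡ true

    swap₁₂ : ∀ {a b c} → R a b c → R b a c
    swap₁₂ {a} {b} {c} = trans (sym₁₂ G (ψ b) (ψ a) (ψ c))

    swap₂₃ : ∀ {a b c} → R a b c → R a c b
    swap₂₃ {a} {b} {c} = trans (sym₂₃ G (ψ a) (ψ c) (ψ b))

  module _ (increasing : ∀ {a b c} → a <ᶠ b → b <ᶠ c → R a b c) where

    private
      first-two-increasing : ∀ {a b c} → a <ᶠ b → b ≢ c → a ≢ c → R a b c
      first-two-increasing {a} {b} {c} a<b b≢c a≢c with <-cmp b c | <-cmp a c
      ... | tri< b<c _ _ | _            = increasing a<b b<c
      ... | tri≈ _ b≡c _ | _            = ⊥-elim (b≢c b≡c)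
      ... | tri> _ _ c<b | tri< a<c _ _ = swap₂₃ (increasing a<c c<b)
      ... | tri> _ _ c<b | tri≈ _ a≡c _ = ⊥-elim (a≢c a≡c)
      ... | tri> _ _ c<b | tri> _ _ c<a = swap₂₃ (swap₁₂ (increasing c<a a<b))

    edge-from-increasing : ∀ {a b c} → a ≢ b → b ≢ c → a ≢ c → R a b c
    edge-from-increasing {a} {b} a≢b b≢c a≢c with <-cmp a b
    ... | tri< a<b _ _ = first-two-increasing a<b b≢c a≢c
    ... | tri≈ _ a≡b _ = ⊥-elim (a≢b a≡b)
    ... | tri> _ _ b<a = swap₁₂ (first-two-increasing b<a a≢c b≢c)

K4-from-faces : (G : ThreeGraph n) (ψ : Fin 4 → Fin n) → Injective _≡_ _≡_ ψ →
                (∀ k → edgeOn G (ψ ∘ punchIn k) ≡ true) → ContainsCopy G K4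
K4-from-faces G ψ ψ-injective faces = ψ , ψ-injective , λ a b c abc →
  let a≢b , b≢c , a≢c = d-true a b c abc in edge-from-increasing G ψ face a≢b b≢c a≢c
  where
  face : ∀ {a b c} → a <ᶠ b → b <ᶠ c → edge G (ψ a) (ψ b) (ψ c) ≡ true
  face a<b b<c with k , refl , refl , refl ← increasing-is-face a<b b<c = faces k

IsMatching : ThreeGraph n → Set
IsMatching S = ∀ {x y z u v} → edge S x y z ≡ true → edge S x u v ≡ true → u ≡ y ⊎ u ≡ z

module _ (σ : Fin m → Fin 3 → Fin n) where

  image? : ∀ b → Decidable λ v → ∃ λ j → v ≡ σ b j
  image? b v = any? λ j → v ≟ σ b j

  triangles : ThreeGraph n
  triangles = ⋃ (clique ∘ image?)

  module _ (σ-injective : Injective _≡_ _≡_ (uncurry σ)) where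

    triangles-edge : ∀ b → edgeOn triangles (σ b) ≡ true
    triangles-edge b = Gb⊆⋃G (clique ∘ image?) b
      (clique-edge⁺ (image? b) (σ-distinct λ ()) (σ-distinct λ ()) (σ-distinct λ ())
                               (0F , refl) (1F , refl) (2F , refl))
      where
      σ-distinct : ∀ {i j} → i ≢ j → σ b i ≢ σ b j
      σ-distinct i≢j = i≢j ∘ cong proj₂ ∘ σ-injective

    triangles-matching : IsMatching triangles
    triangles-matching {x} {y} {z} {u} {v} xyz xuv
      with b  , e  ← ⋃-edge⁻ (clique ∘ image?) {x} {y} {z} xyz
      with b′ , e′ ← ⋃-edge⁻ (clique ∘ image?) {x} {u} {v} xuv
      with (x≢y , y≢z , x≢z) , (i , refl) , (j , refl) , (k , refl)
             ← clique-edge⁻ (image? b) {x} {y} {z} e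
      with (x≢u , _ , _) , (i′ , σbi≡σb′i′) , (l , refl) , _
             ← clique-edge⁻ (image? b′) {x} {u} {v} e′
      with refl ← σ-injective {b , i} {b′ , i′} σbi≡σb′i′
      with Fin3-exhausted i j k l (x≢y ∘ cong (σ b)) (y≢z ∘ cong (σ b)) (x≢z ∘ cong (σ b))
    ... | inj₁ refl        = ⊥-elim (x≢u refl)
    ... | inj₂ (inj₁ refl) = inj₁ refl
    ... | inj₂ (inj₂ refl) = inj₂ refl

K5⁻-without-missing-vertex : ∀ (k : Fin 3) (i : Fin 4) →
                             edgeOn K5⁻ (punchIn (suc (suc k)) ∘ punchIn i) ≡ true
K5⁻-without-missing-vertex = from-yes (all? {n = 3} λ k → all? {n = 4} λ i →
  edgeOn K5⁻ (punchIn (suc (suc k)) ∘ punchIn i) ≟ᵇ true)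

module _ {H S : ThreeGraph n} (H-K4-free : Free K4 H) (S-matching : IsMatching S) where

  module _ (φ : Fin 5 → Fin n) (φ-injective : Injective _≡_ _≡_ φ)
           (φ-edge : ∀ a b c → K5⁻edge a b c ≡ true → edge (H ∪ S) (φ a) (φ b) (φ c) ≡ true)
           where

    private
      s : Fin 5 → Fin 5 → Fin 5 → Bool
      s a b c = edge S (φ a) (φ b) (φ c)

      swap₁₂ : ∀ {a b c} → s a b c ≡ true → s b a c ≡ true
      swap₁₂ {a} {b} {c} = trans (sym₁₂ S (φ b) (φ a) (φ c))

      swap₂₃ : ∀ {a b c} → s a b c ≡ true → s a c b ≡ true
      swap₂₃ {a} {b} {c} = trans (sym₂₃ S (φ a) (φ c) (φ b))

      clash : ∀ {a b c d e} → s a b c ≡ true → s a d e ≡ true → d ≢ b → d ≢ c → ⊥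
      clash abc ade d≢b d≢c = [ d≢b ∘ φ-injective , d≢c ∘ φ-injective ]′ (S-matching abc ade)

      K4-in-H-avoiding : ∀ k → (∀ i → edgeOn S (φ ∘ punchIn (suc (suc k)) ∘ punchIn i) ≢ true) →
                         ⊥
      K4-in-H-avoiding k no-S-face = H-K4-free
        (K4-from-faces H (φ ∘ punchIn (suc (suc k))) (punchIn-injective _ _ _ ∘ φ-injective) H-face)
        where
        H-face : ∀ i → edgeOn H (φ ∘ punchIn (suc (suc k)) ∘ punchIn i) ≡ true
        H-face i = [ id , ⊥-elim ∘ no-S-face i ]′
                     (∨-true⁻ (φ-edge _ _ _ (K5⁻-without-missing-vertex k i)))

    -- An S-edge among the triples of {0,1,2,3} meets, without being equal to, every triple
    -- of {0,1,3,4} if it contains 2 and of {0,1,2,4} otherwise, so by the matching property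
    -- that K₄ lies in H. If there is no such S-edge, {0,1,2,3} itself spans a K₄ in H.
    -- (K4-in-H-avoiding k concerns the K₄ on the vertices other than 2 + k.)
    no-copy : ⊥
    no-copy
      with s 0F 1F 2F ≟ᵇ true | s 0F 1F 3F ≟ᵇ true | s 0F 2F 3F ≟ᵇ true | s 1F 2F 3F ≟ᵇ true
    ... | yes s012 | _ | _ | _ = K4-in-H-avoiding 0F λ where
      0F t → clash (swap₁₂ s012) t (λ ()) (λ ())
      1F t → clash s012 t (λ ()) (λ ())
      2F t → clash s012 (swap₂₃ t) (λ ()) (λ ())
      3F t → clash s012 (swap₂₃ t) (λ ()) (λ ())
    ... | no _ | yes s013 | _ | _ = K4-in-H-avoiding 1F λ where
      0F t → clash (swap₁₂ s013) t (λ ()) (λ ())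
      1F t → clash s013 t (λ ()) (λ ())
      2F t → clash s013 (swap₂₃ t) (λ ()) (λ ())
      3F t → clash s013 (swap₂₃ t) (λ ()) (λ ())
    ... | no _ | no _ | yes s023 | _ = K4-in-H-avoiding 0F λ where
      0F t → clash (swap₁₂ (swap₂₃ s023)) (swap₁₂ t) (λ ()) (λ ())
      1F t → clash s023 (swap₂₃ t) (λ ()) (λ ())
      2F t → clash s023 t (λ ()) (λ ())
      3F t → clash s023 t (λ ()) (λ ())
    ... | no _ | no _ | no _ | yes s123 = K4-in-H-avoiding 0F λ where
      0F t → clash s123 (swap₂₃ t) (λ ()) (λ ())
      1F t → clash (swap₁₂ (swap₂₃ s123)) (swap₁₂ t) (λ ()) (λ ())
      2F t → clash s123 (swap₁₂ t) (λ ()) (λ ())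
      3F t → clash s123 (swap₁₂ t) (λ ()) (λ ())
    ... | no ¬s012 | no ¬s013 | no ¬s023 | no ¬s123 = K4-in-H-avoiding 2F λ where
      0F → ¬s123
      1F → ¬s023
      2F → ¬s013
      3F → ¬s012

  ∪-K5⁻-free : Free K5⁻ (H ∪ S)
  ∪-K5⁻-free (φ , φ-injective , φ-edge) = no-copy φ φ-injective φ-edge

injective⇒≤-length : ∀ {a} {A : Set a} {L : List A} {f : Fin m → A} →
                     Injective _≡_ _≡_ f → (∀ i → f i ∈ L) → m ≤ length L
injective⇒≤-length {L = L} f-injective f∈L = injective⇒≤ {f = index ∘ f∈L} λ {i} {j} eq →
  f-injective (trans (lookup-index (f∈L i)) (trans (cong (lookup L) eq) (sym (lookup-index (f∈L j)))))

filterᵇ-split : ∀ {a} {A : Set a} (f g : A → Bool) → (∀ x → f x ≡ true → g x ≡ true) → ∀ xs →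
                length (filterᵇ f xs) + length (filterᵇ (λ x → g x ∧ not (f x)) xs)
                  ≤ length (filterᵇ g xs)
filterᵇ-split f g f⇒g [] = z≤n
filterᵇ-split f g f⇒g (x ∷ xs) with f x in fx | g x in gx
... | true  | true  = s≤s (filterᵇ-split f g f⇒g xs)
... | true  | false with () ← trans (sym (f⇒g x fx)) gx
... | false | true  = subst (_≤ suc (length (filterᵇ g xs)))
                        (sym (ℕ.+-suc (length (filterᵇ f xs)) _)) (s≤s (filterᵇ-split f g f⇒g xs))
... | false | false = filterᵇ-split f g f⇒g xs

∈-filterᵇ : ∀ {a} {A : Set a} (p : A → Bool) {x} {xs : List A} →
            x ∈ xs → p x ≡ true → x ∈ filterᵇ p xs
∈-filterᵇ p x∈xs px = ∈-filter⁺ (T? ∘ p) x∈xs (subst T (sym px) tt)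

∈-triples : ∀ (i j k : Fin n) → (i , j , k) ∈ triples n
∈-triples i j k =
  ∈-concatMap⁺ _ (lose (∈-allFin i) (∈-concatMap⁺ _ (lose (∈-allFin j) (∈-map⁺ _ (∈-allFin k)))))

module _ (G : ThreeGraph n) {i j k : Fin n} where

  increasing-edge : i <ᶠ j → j <ᶠ k → edge G i j k ≡ true → isIncreasingEdge G (i , j , k) ≡ true
  increasing-edge i<j j<k =
    cong₂ _∧_ (⌊⌋-true (toℕ i ℕ.<? toℕ j) i<j) ∘ cong₂ _∧_ (⌊⌋-true (toℕ j ℕ.<? toℕ k) j<k)

  increasing-non-edge : edge G i j k ≡ false → isIncreasingEdge G (i , j , k) ≡ false
  increasing-non-edge e =
    trans (cong (λ c → a ∧ b ∧ c) e) (trans (cong (a ∧_) (∧-zeroʳ b)) (∧-zeroʳ a))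
    where
    a = ⌊ toℕ i ℕ.<? toℕ j ⌋
    b = ⌊ toℕ j ℕ.<? toℕ k ⌋

isIncreasingEdge-mono : ∀ {G G′ : ThreeGraph n} → G ⊆ G′ → ∀ τ →
                        isIncreasingEdge G τ ≡ true → isIncreasingEdge G′ τ ≡ true
isIncreasingEdge-mono G⊆G′ (i , j , k) =
  ∧∧-monoʳ ⌊ toℕ i ℕ.<? toℕ j ⌋ ⌊ toℕ j ℕ.<? toℕ k ⌋ G⊆G′

numEdges-∪ : ∀ (G G′ : ThreeGraph n) (t : Fin m → Fin n × Fin n × Fin n) →
             Injective _≡_ _≡_ t →
             (∀ b → isIncreasingEdge G′ (t b) ≡ true) →
             (∀ b → isIncreasingEdge G (t b) ≡ false) →
             numEdges G + m ≤ numEdges (G ∪ G′)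
numEdges-∪ {n} G G′ t t-injective new old =
  ℕ.≤-trans (ℕ.+-monoʳ-≤ (numEdges G) (injective⇒≤-length t-injective t-counted))
            (filterᵇ-split (isIncreasingEdge G) (isIncreasingEdge (G ∪ G′))
                           (isIncreasingEdge-mono {G = G} {G ∪ G′} (G⊆G∪G′ G G′)) (triples n))
  where
  t-counted : ∀ b → t b ∈ filterᵇ (λ τ → isIncreasingEdge (G ∪ G′) τ ∧ not (isIncreasingEdge G τ))
                                  (triples n)
  t-counted b with t b | new b | old b
  ... | (i , j , k) | new-b | old-b = ∈-filterᵇ _ (∈-triples i j k)
    (cong₂ _∧_ (isIncreasingEdge-mono {G = G′} {G ∪ G′} (G′⊆G∪G′ G G′) (i , j , k) new-b)
               (cong not old-b))

record MatchingExtension (H : ThreeGraph n) (m : ℕ) : Set where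
  field
    matching       : ThreeGraph n
    isMatching     : IsMatching matching
    numEdges-bound : numEdges H + m ≤ numEdges (H ∪ matching)

module _ (m*4≤n : m * 4 ≤ n) where

  block : Fin m → Fin 4 → Fin n
  block b r = inject≤ (combine b r) m*4≤n

  block-injective : ∀ {b b′ r r′} → block b r ≡ block b′ r′ → b ≡ b′ × r ≡ r′
  block-injective {b} {b′} {r} {r′} = combine-injective b r b′ r′ ∘ inject≤-injective _ _ _ _

  block-mono-< : ∀ b {r r′} → r <ᶠ r′ → block b r <ᶠ block b r′
  block-mono-< b {r} {r′} r<r′ = begin-strict
    toℕ (block b r)     ≡⟨ toℕ-inject≤ (combine b r) m*4≤n ⟩
    toℕ (combine b r)   ≡⟨ toℕ-combine b r ⟩
    4 * toℕ b + toℕ r   <⟨ ℕ.+-monoʳ-< (4 * toℕ b) r<r′ ⟩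
    4 * toℕ b + toℕ r′  ≡⟨ toℕ-combine b r′ ⟨
    toℕ (combine b r′)  ≡⟨ toℕ-inject≤ (combine b r′) m*4≤n ⟨
    toℕ (block b r′)    ∎
    where open ℕ.≤-Reasoning

  module _ (hole : Fin m → Fin 4) where

    punctured : Fin m → Fin 3 → Fin n
    punctured b = block b ∘ punchIn (hole b)

    punctured-injective : Injective _≡_ _≡_ (uncurry punctured)
    punctured-injective {b , i} {b′ , j} eq with block-injective {b} {b′} eq
    ... | refl , r≡r′ = cong (b ,_) (punchIn-injective (hole b) i j r≡r′)

    punctured-extension : ∀ {H : ThreeGraph n} → (∀ b → edgeOn H (punctured b) ≢ true) →
                          MatchingExtension H m
    punctured-extension {H} punctured-missing = record
      { matching       = triangles punctured
      ; isMatching     = triangles-matching punctured punctured-injective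
      ; numEdges-bound = numEdges-∪ H (triangles punctured) t t-injective new old
      }
      where
      t : Fin m → Fin n × Fin n × Fin n
      t b = punctured b 0F , punctured b 1F , punctured b 2F

      t-injective : Injective _≡_ _≡_ t
      t-injective = cong proj₁ ∘ punctured-injective ∘ cong proj₁

      punctured-increasing : ∀ b {i j} → i <ᶠ j → punctured b i <ᶠ punctured b j
      punctured-increasing b = block-mono-< b ∘ punchIn-mono-< (hole b)

      new : ∀ b → isIncreasingEdge (triangles punctured) (t b) ≡ true
      new b = increasing-edge (triangles punctured)
                (punctured-increasing b (s≤s z≤n)) (punctured-increasing b (s≤s (s≤s z≤n)))
                (triangles-edge punctured punctured-injective b)

      old : ∀ b → isIncreasingEdge H (t b) ≡ false
      old b = increasing-non-edge H (¬-not (punctured-missing b))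

  module _ {H : ThreeGraph n} (H-K4-free : Free K4 H) where

    missing-face : ∀ b → ∃ λ k → edgeOn H (block b ∘ punchIn k) ≢ true
    missing-face b = ¬∀⟶∃¬ 4 _ (λ k → edgeOn H (block b ∘ punchIn k) ≟ᵇ true)
      (H-K4-free ∘ K4-from-faces H (block b) λ {r} {r′} → proj₂ ∘ block-injective {b} {b} {r} {r′})

    K4-free-extension : MatchingExtension H m
    K4-free-extension = punctured-extension (proj₁ ∘ missing-face) {H} (proj₂ ∘ missing-face)

ex-K4+m≤ex-K5⁻ : ∀ {n m a b} → m * 4 ≤ n → IsEx n K4 a → IsEx n K5⁻ b → a + m ≤ b
ex-K4+m≤ex-K5⁻ {m = m} m*4≤n ((H , H-K4-free , refl) , _) (_ , K5⁻-extremal) =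
  ℕ.≤-trans numEdges-bound
            (K5⁻-extremal (H ∪ matching) (∪-K5⁻-free {H = H} {matching} H-K4-free isMatching))
  where open MatchingExtension (K4-free-extension {m} m*4≤n {H} H-K4-free)

n/5*4≤n : ∀ n → n / 5 * 4 ≤ n
n/5*4≤n n = ℕ.≤-trans (ℕ.*-mono-≤ (ℕ.≤-refl {n / 5}) (ℕ.n≤1+n 4)) (m/n*n≤m n 5)

proposition2p1 : ∀ (n a b : ℕ) → IsEx n K4 a → IsEx n K5⁻ b → a + n / 5 ≤ b
proposition2p1 n a b = ex-K4+m≤ex-K5⁻ (n/5*4≤n n)
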